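{- For any poset $\mathcal{P}$ on $n$ elements with split $\mathcal{Q}$, $$\operatorname{lc}_{\mathfrak{D}}(G_{\mathcal{Q}})-4\le \operatorname{ldim}(\mathcal{P})\le \operatorname{lc}_{\mathfrak{D}}(G_{\mathcal{Q}})\cdot(1+o(1))\log_2 n,$$ where $o(1)$ denotes a quantity tending to $0$ as $n\to\infty$.
   Context: Local covering numbers: for a class $\mathfrak{F}$ of graphs and a graph $H$, an $\mathfrak{F}$-covering of $H$ is a set of subgraphs $G_1,\dots,G_t$ of $H$, each in $\mathfrak{F}$, whose union is $H$; it is $k$-local if every vertex of $H$ lies in at most $k$ of the $G_i$; $\operatorname{lc}_{\mathfrak{F}}(H)$ is the least such $k$. $\mathfrak{D}$ is the class of difference graphs: bipartite graphs in which the vertices of one part can be ordered $a_1,\dots,a_r$ with $N(a_i)\subseteq N(a_{i-1})$ for $i=2,\dots,r$. Local dimension: a partial linear extension of a poset $\mathcal{P}=(P,\le)$ is a linear extension of an induced subposet. A local realizer is a nonempty set $\mathcal{L}$ of partial linear extensions such that (1) if $x<y$ in $\mathcal{P}$ then $x<y$ in some $L\in\mathcal{L}$, and (2) if $x,y$ are incomparable then $x<y$ in some $L\in\mathcal{L}$ and $y<x$ in some $L'\in\mathcal{L}$. $\operatorname{ldim}(\mathcal{P})$ is the least $k$ such that some local realizer has every element of $P$ in at most $k$ of its members. The split of $\mathcal{P}$ is the height-two poset $\mathcal{Q}$ with minimal elements $\{x' : x\in P\}$ and maximal elements $\{x'': x\in P\}$, where $x'<y''$ iff $x\le y$ in $\mathcal{P}$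 (and no other strict relations). For a height-two poset $\mathcal{Q}$, $G_{\mathcal{Q}}$ is the bipartite graph with parts $A=\min(\mathcal{Q})$ (set of minimal elements) and $B=Q\setminus\min(\mathcal{Q})$, where $x\in A$, $y\in B$ are adjacent iff $x$ and $y$ are incomparable in $\mathcal{Q}$. -}

module Defs where

open import Level using (0ℓ)
open import Data.Nat using (ℕ; _≤_; _<_; suc)
open import Data.Fin using (Fin; toℕ)
open import Data.Fin.Properties using (_≟_)
open import Data.Bool using (Bool; true; false)
open import Data.Sum using (_⊎_; inj₁; inj₂)
open import Data.Product using (Σ; ∃; ∃-syntax; _×_; _,_)
open import Data.Empty using (⊥)
open import Data.List using (List; []; _∷_; length; lookup; filter; filterᵇ)
open import Data.List.Membership.Propositional using (_∈_)
import Data.List.Membership.DecPropositional as DecMemM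
open import Data.List.Relation.Unary.Unique.Propositional using (Unique)
open import Data.List.Relation.Unary.Linked using (Linked)
open import Relation.Nullary using (¬_)
open import Relation.Binary using (Rel; IsPartialOrder; Decidable)
open import Relation.Binary.PropositionalEquality using (_≡_; _≢_)

record FinPoset (n : ℕ) : Set₁ where
  field
    _≼_            : Rel (Fin n) 0ℓ
    isPartialOrder : IsPartialOrder _≡_ _≼_
    _≼?_           : Decidable _≼_

module LocalDim {n : ℕ} (P : FinPoset n) where
  open FinPoset P
  module DecMem = DecMemM (_≟_ {n})

  _≺_ : Fin n → Fin n → Set
  x ≺ y = x ≼ y × x ≢ y

  _∥_ : Fin n → Fin n → Set
  x ∥ y = ¬ (x ≼ y) × ¬ (y ≼ x)

  Before : List (Fin n) → Fin n → Fin n → Set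
  Before L x y = Σ (Fin (length L)) λ i → Σ (Fin (length L)) λ j →
    toℕ i < toℕ j × lookup L i ≡ x × lookup L j ≡ y

  -- A partial linear extension: a linear extension of the subposet
  -- induced on the (distinct) elements of L, listed in increasing order.
  IsPartialLinExt : List (Fin n) → Set
  IsPartialLinExt L =
    Unique L × (∀ x y → x ∈ L → y ∈ L → x ≺ y → Before L x y)

  count : List (List (Fin n)) → Fin n → ℕ
  count ℒ x = length (filter (λ L → x DecMem.∈? L) ℒ)

  IsLocalRealizer : List (List (Fin n)) → Set
  IsLocalRealizer ℒ =
    (∃ λ L → L ∈ ℒ)
    × (∀ L → L ∈ ℒ → IsPartialLinExt L)
    × (∀ x y → x ≺ y → ∃ λ L → L ∈ ℒ × Before L x y)
    × (∀ x y → x ∥ y → (∃ λ L → L ∈ ℒ × Before L x y)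
                       × (∃ λ L → L ∈ ℒ × Before L y x))

  HasLocalRealizer : ℕ → Set
  HasLocalRealizer k = ∃ λ ℒ → IsLocalRealizer ℒ × (∀ x → count ℒ x ≤ k)

  IsLdim : ℕ → Set
  IsLdim d = HasLocalRealizer d × (∀ k → HasLocalRealizer k → d ≤ k)

-- Graphs: a graph on a vertex type V given by a (symmetric) adjacency
-- relation; subgraphs given by Bool-valued vertex / edge indicators.

record SubGraph (V : Set) : Set where
  field
    vs : V → Bool
    es : V → V → Bool
open SubGraph public

IsSubgraphOf : {V : Set} → SubGraph V → (V → V → Set) → Set
IsSubgraphOf G adj =
  (∀ u v → es G u v ≡ es G v u)
  × (∀ u v → es G u v ≡ true → vs G u ≡ true × vs G v ≡ true)
  × (∀ u v → es G u v ≡ true → adj u v)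

-- Difference graphs: bipartite (bipartition given by side X) such that the
-- vertices of one part (side X = true) can be listed a₁,…,a_r with
-- N(aᵢ) ⊆ N(aᵢ₋₁).
IsDifferenceGraph : {V : Set} → SubGraph V → Set
IsDifferenceGraph {V} G =
  Σ (V → Bool) λ X →
    (∀ u v → es G u v ≡ true → X u ≢ X v)
    × Σ (List V) λ as →
        Unique as
        × (∀ a → a ∈ as → vs G a ≡ true × X a ≡ true)
        × (∀ a → vs G a ≡ true → X a ≡ true → a ∈ as)
        × Linked (λ a b → ∀ w → es G b w ≡ true → es G a w ≡ true) as

module LocalCover {V : Set} (adj : V → V → Set) where

  countG : List (SubGraph V) → V → ℕ
  countG Gs v = length (filterᵇ (λ G → vs G v) Gs)

  -- a 𝔇-covering of H = (V, adj) (all of V are vertices of H)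
  IsDCovering : List (SubGraph V) → Set
  IsDCovering Gs =
    (∀ G → G ∈ Gs → IsSubgraphOf G adj × IsDifferenceGraph G)
    × (∀ v → ∃ λ G → G ∈ Gs × vs G v ≡ true)
    × (∀ u v → adj u v → ∃ λ G → G ∈ Gs × es G u v ≡ true)

  HasLocalCovering : ℕ → Set
  HasLocalCovering k = ∃ λ Gs → IsDCovering Gs × (∀ v → countG Gs v ≤ k)

  IsLc : ℕ → Set
  IsLc c = HasLocalCovering c × (∀ k → HasLocalCovering k → c ≤ k)

module GraphOfPoset {V : Set} (_≤Q_ : V → V → Set) where
  Minimal : V → Set
  Minimal a = ∀ b → b ≤Q a → b ≡ a

  EdgeAB : V → V → Set
  EdgeAB x y = Minimal x × ¬ Minimal y × ¬ (x ≤Q y) × ¬ (y ≤Q x)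

  GQ-adj : V → V → Set
  GQ-adj u v = EdgeAB u v ⊎ EdgeAB v u

-- The split: inj₁ x = x′ (minimal copy), inj₂ x = x″ (maximal copy)
splitLe : {n : ℕ} → FinPoset n → Fin n ⊎ Fin n → Fin n ⊎ Fin n → Set
splitLe P (inj₁ x) (inj₁ y) = x ≡ y
splitLe P (inj₁ x) (inj₂ y) = FinPoset._≼_ P x y
splitLe P (inj₂ x) (inj₁ y) = ⊥
splitLe P (inj₂ x) (inj₂ y) = x ≡ y

GSplit : {n : ℕ} → FinPoset n → Fin n ⊎ Fin n → Fin n ⊎ Fin n → Set
GSplit P = GraphOfPoset.GQ-adj (splitLe P)

IsLdim : {n : ℕ} → FinPoset n → ℕ → Set
IsLdim P = LocalDim.IsLdim P

IsLcD : {V : Set} → (V → V → Set) → ℕ → Set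
IsLcD adj = LocalCover.IsLc adj

module Submission where

-- A local realizer ℒ of P yields a 𝔇-covering of G_Q: for L ∈ ℒ the edges x′y″ with y before x
-- in L form a difference graph, because the neighbourhoods of the y″ shrink along L; every edge
-- x′y″ of G_Q (that is, x ≰ y) is reversed by some L, so lc ≤ ldim + 1.
-- Conversely, a difference subgraph G of G_Q is 2K2-free, so if x′y″ ∈ G and u ≤ y then
-- N(u′) ⊊ N(x′). Sorting the elements of G by the largest degree of some u′ with u below them,
-- ties broken by a linear extension of P, therefore gives a partial linear extension putting y
-- before x for every edge x′y″ of G. These, with one linear extension of P, form a local
-- realizer, so ldim ≤ 2 lc + 1, and for n ≥ 8: 2^(dq) ≤ 2^(3cq) = 8^(cq) ≤ n^(c(q+p)).

open import Defs
open import Data.Nat using (ℕ; _≤_; _+_; _*_; _^_)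
open import Data.Product using (_×_; ∃)

open import Level using (0ℓ)
open import Data.Nat using (suc; _<_; z≤n; s≤s)
open import Data.Nat.Properties
open import Data.Bool using (Bool; true; false; T)
import Data.Bool as Bool
open import Data.Bool.Properties using (T-≡)
open import Data.Empty using (⊥-elim)
open import Data.Fin as Fin using (Fin)
import Data.Fin.Properties as Fin
open import Data.Product using (_,_; proj₁; proj₂)
open import Data.Sum as Sum using (_⊎_; inj₁; inj₂; [_,_]′; reduce; swap)
open import Data.Sum.Properties using (inj₂-injective)
open import Data.List using (List; []; _∷_; length; map; filter; filterᵇ; allFin)
open import Data.List.Properties using (filter-some; length-filter; length-tabulate)
open import Data.List.Extrema.Nat using (max; max-mono-⊆; max<v⁺; xs≤max)
open import Data.List.Membership.Propositional using (_∈_; lose)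
open import Data.List.Membership.Propositional.Properties
  using (∈-map⁺; ∈-map⁻; ∈-allFin; ∈-filter⁺; ∈-filter⁻; ∈-lookup)
open import Data.List.Relation.Unary.Any.Properties using (lookup-index)
import Data.List.Membership.DecPropositional as DecMembership
open import Data.List.Relation.Unary.Any using (here; there; index)
import Data.List.Relation.Unary.All as All
import Data.List.Relation.Unary.All.Properties as All
open import Data.List.Relation.Unary.AllPairs using (AllPairs; []; _∷_)
open import Data.List.Relation.Unary.Linked as Linked using (Linked; []; [-]; _∷_)
import Data.List.Relation.Unary.Linked.Properties as Linked
open import Data.List.Relation.Unary.Unique.Propositional using (Unique)
import Data.List.Relation.Unary.Unique.Propositional.Properties as Unique
import Data.List.Relation.Binary.Sublist.Propositional as Sublist
import Data.List.Relation.Binary.Sublist.Propositional.Properties as Sublist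
import Data.List.Relation.Binary.Subset.Propositional.Properties as Subset using (map⁺)
open import Data.List.Relation.Binary.Permutation.Propositional using (↭-sym; ↭⇒↭ₛ)
open import Data.List.Relation.Binary.Permutation.Propositional.Properties using (∈-resp-↭)
import Data.List.Relation.Binary.Permutation.Setoid.Properties as Permutationₛ
import Data.List.Relation.Unary.Sorted.TotalOrder.Properties as Sorted
import Data.List.Sort as Sort
open import Function using (_∘_; Equivalence)
open import Relation.Nullary using (¬_; Dec; yes; no; does)
open import Relation.Nullary.Decidable using (dec-true; T?; _⊎-dec_)
open import Relation.Unary using (Pred)
import Relation.Unary as U
open import Relation.Binary using (Rel; Reflexive; DecidableEquality; IsPartialOrder)
open import Relation.Binary.Bundles using (DecTotalOrder)
import Relation.Binary.Construct.On as On
open import Relation.Binary.PropositionalEquality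
  using (_≡_; _≢_; refl; sym; trans; cong; setoid)

dec-true⁻ : ∀ {A : Set} (a? : Dec A) → does a? ≡ true → A
dec-true⁻ (yes a) _ = a

T-does⁻ : ∀ {A : Set} (a? : Dec A) → T (does a?) → A
T-does⁻ a? = dec-true⁻ a? ∘ Equivalence.to T-≡

module _ {A : Set} {P Q : Pred A 0ℓ} (P? : U.Decidable P) (Q? : U.Decidable Q) where

  length-filter-mono : (∀ {x} → P x → Q x) → ∀ xs →
    length (filter P? xs) ≤ length (filter Q? xs)
  length-filter-mono P⇒Q xs =
    Sublist.length-mono-≤ (Sublist.filter⁺ P? Q? (λ { refl → P⇒Q }) (Sublist.⊆-refl {x = xs}))

  length-filter-< : (∀ {x} → P x → Q x) → ∀ {w} xs → w ∈ xs → Q w → ¬ P w →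
    length (filter P? xs) < length (filter Q? xs)
  length-filter-< P⇒Q (x ∷ xs) w∈ Qw ¬Pw with P? x | Q? x | w∈
  ... | yes Px | no ¬Qx | _          = ⊥-elim (¬Qx (P⇒Q Px))
  ... | yes Px | yes _  | here refl  = ⊥-elim (¬Pw Px)
  ... | yes _  | yes _  | there w∈xs = s≤s (length-filter-< P⇒Q xs w∈xs Qw ¬Pw)
  ... | no _   | yes _  | here refl  = s≤s (length-filter-mono P⇒Q xs)
  ... | no _   | yes _  | there w∈xs = m<n⇒m<1+n (length-filter-< P⇒Q xs w∈xs Qw ¬Pw)
  ... | no _   | no ¬Qx | here refl  = ⊥-elim (¬Qx Qw)
  ... | no _   | no _   | there w∈xs = length-filter-< P⇒Q xs w∈xs Qw ¬Pw

  length-filter-⊎ : ∀ xs → length (filter (λ x → P? x ⊎-dec Q? x) xs)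
                          ≤ length (filter P? xs) + length (filter Q? xs)
  length-filter-⊎ [] = z≤n
  length-filter-⊎ (x ∷ xs) with P? x | Q? x
  ... | yes _ | yes _ = s≤s (≤-trans (length-filter-⊎ xs) (+-monoʳ-≤ _ (n≤1+n _)))
  ... | yes _ | no _  = s≤s (length-filter-⊎ xs)
  ... | no _  | yes _ = ≤-trans (s≤s (length-filter-⊎ xs)) (≤-reflexive (sym (+-suc _ _)))
  ... | no _  | no _  = length-filter-⊎ xs

length-filter-map : ∀ {A B : Set} {P : Pred B 0ℓ} (P? : U.Decidable P) (f : A → B) xs →
  length (filter P? (map f xs)) ≡ length (filter (P? ∘ f) xs)
length-filter-map P? f [] = refl
length-filter-map P? f (x ∷ xs) with does (P? (f x))
... | true  = cong suc (length-filter-map P? f xs)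
... | false = length-filter-map P? f xs

AllPairs-total : ∀ {A : Set} {R : Rel A 0ℓ} → Reflexive R → ∀ {L x y} →
  AllPairs R L → x ∈ L → y ∈ L → R x y ⊎ R y x
AllPairs-total refl-R (_  ∷ _)   (here refl) (here refl) = inj₁ refl-R
AllPairs-total refl-R (Rx ∷ _)   (here refl) (there y∈) = inj₁ (All.lookup Rx y∈)
AllPairs-total refl-R (Rx ∷ _)   (there x∈) (here refl) = inj₂ (All.lookup Rx x∈)
AllPairs-total refl-R (_  ∷ Rxs) (there x∈) (there y∈) = AllPairs-total refl-R Rxs x∈ y∈

module _ {A : Set} where

  data Precedes : List A → A → A → Set where
    here  : ∀ {x y L} → y ∈ L → Precedes (x ∷ L) x y
    there : ∀ {a x y L} → Precedes L x y → Precedes (a ∷ L) x y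

  precedes-∈ˡ : ∀ {L x y} → Precedes L x y → x ∈ L
  precedes-∈ˡ (here _)  = here refl
  precedes-∈ˡ (there p) = there (precedes-∈ˡ p)

  precedes-∈ʳ : ∀ {L x y} → Precedes L x y → y ∈ L
  precedes-∈ʳ (here y∈) = there y∈
  precedes-∈ʳ (there p) = there (precedes-∈ʳ p)

  precedes-irrefl : ∀ {L x} → Unique L → ¬ Precedes L x x
  precedes-irrefl (x∉ ∷ _) (here x∈)  = All.lookup x∉ x∈ refl
  precedes-irrefl (_ ∷ uniq) (there p) = precedes-irrefl uniq p

  precedes-asym : ∀ {L x y} → Unique L → Precedes L x y → ¬ Precedes L y x
  precedes-asym (x∉ ∷ _) (here y∈) (here _)   = All.lookup x∉ y∈ refl
  precedes-asym (x∉ ∷ _) (here _)  (there q)  = All.lookup x∉ (precedes-∈ʳ q) refl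
  precedes-asym (y∉ ∷ _) (there p) (here _)   = All.lookup y∉ (precedes-∈ʳ p) refl
  precedes-asym (_ ∷ uniq) (there p) (there q) = precedes-asym uniq p q

  precedes-trans : ∀ {L} → Unique L → ∀ {x y z} → Precedes L x y → Precedes L y z → Precedes L x z
  precedes-trans (x∉ ∷ _) (here y∈) (here _)  = ⊥-elim (All.lookup x∉ y∈ refl)
  precedes-trans (_ ∷ _)  (here _)  (there q) = here (precedes-∈ʳ q)
  precedes-trans (y∉ ∷ _) (there p) (here _)  = ⊥-elim (All.lookup y∉ (precedes-∈ʳ p) refl)
  precedes-trans (_ ∷ uniq) (there p) (there q) = there (precedes-trans uniq p q)

  linked-precedes : ∀ L → Linked (Precedes L) L
  linked-precedes []          = []
  linked-precedes (x ∷ [])    = [-]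
  linked-precedes (x ∷ y ∷ L) = here (here refl) ∷ Linked.map there (linked-precedes (y ∷ L))

  AllPairs⇒precedes : ∀ {R : Rel A 0ℓ} → Reflexive R → ∀ {L x y} →
    AllPairs R L → x ∈ L → y ∈ L → ¬ R y x → Precedes L x y
  AllPairs⇒precedes refl-R (_  ∷ _)   (here refl) (here refl) ¬Ryx = ⊥-elim (¬Ryx refl-R)
  AllPairs⇒precedes refl-R (_  ∷ _)   (here refl) (there y∈) _    = here y∈
  AllPairs⇒precedes refl-R (Rx ∷ _)   (there x∈) (here refl) ¬Ryx = ⊥-elim (¬Ryx (All.lookup Rx x∈))
  AllPairs⇒precedes refl-R (_  ∷ Rxs) (there x∈) (there y∈) ¬Ryx =
    there (AllPairs⇒precedes refl-R Rxs x∈ y∈ ¬Ryx)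

  module _ (_≟_ : DecidableEquality A) where
    open DecMembership _≟_ using (_∈?_)

    precedes? : ∀ L x y → Dec (Precedes L x y)
    precedes? [] x y = no λ ()
    precedes? (a ∷ L) x y with a ≟ x | y ∈? L | precedes? L x y
    ... | _        | _       | yes p = yes (there p)
    ... | yes refl | yes y∈  | no _  = yes (here y∈)
    ... | yes refl | no y∉   | no ¬p = no λ { (here y∈) → y∉ y∈ ; (there p) → ¬p p }
    ... | no a≢x   | _       | no ¬p = no λ { (here _) → a≢x refl ; (there p) → ¬p p }

module SortBy {A : Set} (key : A → ℕ) where
  private
    byKey : DecTotalOrder 0ℓ 0ℓ 0ℓ
    byKey = On.decTotalOrder ≤-decTotalOrder key
  open Sort byKey using (sort; sort-↭; sort-↗)

  sortBy : List A → List A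
  sortBy = sort

  ∈-sortBy⁺ : ∀ {x L} → x ∈ L → x ∈ sortBy L
  ∈-sortBy⁺ {L = L} = ∈-resp-↭ (↭-sym (sort-↭ L))

  ∈-sortBy⁻ : ∀ {x L} → x ∈ sortBy L → x ∈ L
  ∈-sortBy⁻ {L = L} = ∈-resp-↭ (sort-↭ L)

  sortBy-unique : ∀ {L} → Unique L → Unique (sortBy L)
  sortBy-unique {L} = Permutationₛ.Unique-resp-↭ (setoid A) (↭⇒↭ₛ (↭-sym (sort-↭ L)))

  sortBy-precedes : ∀ {L x y} → x ∈ L → y ∈ L → key x < key y → Precedes (sortBy L) x y
  sortBy-precedes {L} x∈ y∈ x<y =
    AllPairs⇒precedes ≤-refl (Sorted.Sorted⇒AllPairs (DecTotalOrder.totalOrder byKey) (sort-↗ L))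
      (∈-sortBy⁺ x∈) (∈-sortBy⁺ y∈) (<⇒≱ x<y)

open SortBy using (sortBy; ∈-sortBy⁻; sortBy-unique; sortBy-precedes)

module _ {V : Set} where

  edgelessGraph : SubGraph V
  edgelessGraph = record { vs = λ _ → true ; es = λ _ _ → false }

  edgeless-subgraph : (adj : V → V → Set) → IsSubgraphOf edgelessGraph adj
  edgeless-subgraph adj = (λ _ _ → refl) , (λ _ _ ()) , (λ _ _ ())

  edgeless-difference : IsDifferenceGraph edgelessGraph
  edgeless-difference = (λ _ → false) , (λ _ _ ()) , [] , [] , (λ _ ()) , (λ _ _ ()) , []

  private
    Edge : SubGraph V → V → V → Set
    Edge G u v = es G u v ≡ true

  difference-2K2-free : ∀ {adj G} → IsSubgraphOf G adj → IsDifferenceGraph G → ∀ {a b c d} →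
    Edge G a b → Edge G c d → Edge G a d ⊎ Edge G c b ⊎ Edge G a c ⊎ Edge G b d
  difference-2K2-free {G = G} (symmetric , endpoints , _) (X , bipartite , as , _ , _ , complete , nested)
                      {a} {b} {c} {d} ab cd = by-sides (true-side ab) (true-side cd)
    where
    flip : ∀ {u v} → Edge G u v → Edge G v u
    flip {u} {v} e = trans (sym (symmetric u v)) e

    Dominates : V → V → Set
    Dominates u v = ∀ w → Edge G v w → Edge G u w

    true-side : ∀ {u v} → Edge G u v → X u ≡ true ⊎ X v ≡ true
    true-side {u} {v} e with X u | X v | bipartite u v e
    ... | true  | _     | _   = inj₁ refl
    ... | false | true  | _   = inj₂ refl
    ... | false | false | X≢ = ⊥-elim (X≢ refl)

    listed : ∀ {u v} → Edge G u v → X u ≡ true → u ∈ as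
    listed {u} {v} e Xu = complete u (proj₁ (endpoints u v e)) Xu

    comparable : ∀ {u v} → u ∈ as → v ∈ as → Dominates u v ⊎ Dominates v u
    comparable = AllPairs-total (λ _ e → e)
      (Linked.Linked⇒AllPairs (λ u⊒v v⊒w x e → u⊒v x (v⊒w x e)) nested)

    by-sides : X a ≡ true ⊎ X b ≡ true → X c ≡ true ⊎ X d ≡ true →
      Edge G a d ⊎ Edge G c b ⊎ Edge G a c ⊎ Edge G b d
    by-sides (inj₁ Xa) (inj₁ Xc) = [ (λ a⊒c → inj₁ (a⊒c d cd))
                                   , (λ c⊒a → inj₂ (inj₁ (c⊒a b ab))) ]′
                                   (comparable (listed ab Xa) (listed cd Xc))
    by-sides (inj₁ Xa) (inj₂ Xd) = [ (λ a⊒d → inj₂ (inj₂ (inj₁ (a⊒d c (flip cd)))))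
                                   , (λ d⊒a → inj₂ (inj₂ (inj₂ (flip (d⊒a b ab))))) ]′
                                   (comparable (listed ab Xa) (listed (flip cd) Xd))
    by-sides (inj₂ Xb) (inj₁ Xc) = [ (λ b⊒c → inj₂ (inj₂ (inj₂ (b⊒c d cd))))
                                   , (λ c⊒b → inj₂ (inj₂ (inj₁ (flip (c⊒b a (flip ab)))))) ]′
                                   (comparable (listed (flip ab) Xb) (listed cd Xc))
    by-sides (inj₂ Xb) (inj₂ Xd) = [ (λ b⊒d → inj₂ (inj₁ (flip (b⊒d c (flip cd)))))
                                   , (λ d⊒b → inj₁ (flip (d⊒b a (flip ab)))) ]′
                                   (comparable (listed (flip ab) Xb) (listed (flip cd) Xd))

  module _ (adj : V → V → Set) where
    open LocalCover adj

    localCovering-positive : ∀ {k} → V → HasLocalCovering k → 1 ≤ k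
    localCovering-positive v (Gs , (_ , covers , _) , load) with covers v
    ... | G , G∈ , v∈G =
      ≤-trans (filter-some (T? ∘ (λ G → vs G v)) (lose G∈ (Equivalence.from T-≡ v∈G))) (load v)


module _ {n : ℕ} (P : FinPoset n) where
  open FinPoset P
  open LocalDim P
  open GraphOfPoset (splitLe P) using (Minimal)
  open LocalCover (GSplit P) using (HasLocalCovering; countG)
  private
    module ≼ = IsPartialOrder isPartialOrder

  Precedes⇒Before : ∀ {L x y} → Precedes L x y → Before L x y
  Precedes⇒Before (here y∈) = Fin.zero , Fin.suc (index y∈) , s≤s z≤n , refl , sym (lookup-index y∈)
  Precedes⇒Before (there p) with Precedes⇒Before p
  ... | i , j , i<j , x≡ , y≡ = Fin.suc i , Fin.suc j , s≤s i<j , x≡ , y≡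

  Before⇒Precedes : ∀ L {x y} → Before L x y → Precedes L x y
  Before⇒Precedes (_ ∷ L) (Fin.zero , Fin.suc j , _ , refl , refl) = here (∈-lookup j)
  Before⇒Precedes (_ ∷ L) (Fin.suc i , Fin.suc j , s≤s i<j , x≡ , y≡) =
    there (Before⇒Precedes L (i , j , i<j , x≡ , y≡))
  Before⇒Precedes (_ ∷ L) (_ , Fin.zero , () , _)

  partialLinExt-precedes⇒⋠ : ∀ {L x y} → IsPartialLinExt L → Precedes L y x → ¬ x ≼ y
  partialLinExt-precedes⇒⋠ {L} {x} {y} (uniq , linear) y<x x≼y with x Fin.≟ y
  ... | yes refl = precedes-irrefl uniq y<x
  ... | no x≢y   = precedes-asym uniq y<x
    (Before⇒Precedes L (linear x y (precedes-∈ʳ y<x) (precedes-∈ˡ y<x) (x≼y , x≢y)))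

  sortBy-partialLinExt : (key : Fin n → ℕ) → (∀ {x y} → x ≺ y → key x < key y) →
    ∀ {S} → Unique S → IsPartialLinExt (sortBy key S)
  sortBy-partialLinExt key key-strict uniq = sortBy-unique key uniq ,
    λ x y x∈ y∈ x≺y → Precedes⇒Before
      (sortBy-precedes key (∈-sortBy⁻ key x∈) (∈-sortBy⁻ key y∈) (key-strict x≺y))

  localRealizer-reverses : ∀ {ℒ} → IsLocalRealizer ℒ → ∀ {x y} → ¬ x ≼ y →
    ∃ λ L → L ∈ ℒ × Before L y x
  localRealizer-reverses (_ , _ , comparable , incomparable) {x} {y} x⋠y with y ≼? x
  ... | yes y≼x = comparable y x (y≼x , λ { refl → x⋠y ≼.refl })
  ... | no y⋠x  = proj₂ (incomparable x y (x⋠y , y⋠x))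

  inj₁-minimal : ∀ x → Minimal (inj₁ x)
  inj₁-minimal x (inj₁ _) refl = refl
  inj₁-minimal x (inj₂ _) ()

  inj₂-nonminimal : ∀ y → ¬ Minimal (inj₂ y)
  inj₂-nonminimal y y-minimal with y-minimal (inj₁ y) ≼.refl
  ... | ()

  GSplit⁺ : ∀ {x y} → ¬ x ≼ y → GSplit P (inj₁ x) (inj₂ y)
  GSplit⁺ x⋠y = inj₁ (inj₁-minimal _ , inj₂-nonminimal _ , x⋠y , λ ())

  GSplit⁻ : ∀ {x y} → GSplit P (inj₁ x) (inj₂ y) → ¬ x ≼ y
  GSplit⁻ (inj₁ (_ , _ , x⋠y , _)) = x⋠y
  GSplit⁻ (inj₂ (y-minimal , _))   = ⊥-elim (inj₂-nonminimal _ y-minimal)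

  ¬GSplit-inj₁-inj₁ : ∀ {x y} → ¬ GSplit P (inj₁ x) (inj₁ y)
  ¬GSplit-inj₁-inj₁ (inj₁ (_ , y-nonminimal , _)) = y-nonminimal (inj₁-minimal _)
  ¬GSplit-inj₁-inj₁ (inj₂ (_ , x-nonminimal , _)) = x-nonminimal (inj₁-minimal _)

  ¬GSplit-inj₂-inj₂ : ∀ {x y} → ¬ GSplit P (inj₂ x) (inj₂ y)
  ¬GSplit-inj₂-inj₂ (inj₁ (x-minimal , _)) = inj₂-nonminimal _ x-minimal
  ¬GSplit-inj₂-inj₂ (inj₂ (y-minimal , _)) = inj₂-nonminimal _ y-minimal

  inversionEdge : List (Fin n) → Fin n ⊎ Fin n → Fin n ⊎ Fin n → Bool
  inversionEdge L (inj₁ x) (inj₂ y) = does (precedes? Fin._≟_ L y x)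
  inversionEdge L (inj₂ y) (inj₁ x) = does (precedes? Fin._≟_ L y x)
  inversionEdge L (inj₁ _) (inj₁ _) = false
  inversionEdge L (inj₂ _) (inj₂ _) = false

  inversionGraph : List (Fin n) → SubGraph (Fin n ⊎ Fin n)
  inversionGraph L = record { vs = λ v → does (reduce v DecMem.∈? L) ; es = inversionEdge L }

  inversionGraph-subgraph : ∀ {L} → IsPartialLinExt L → IsSubgraphOf (inversionGraph L) (GSplit P)
  inversionGraph-subgraph {L} L-linear = symmetric , endpoints , adjacent
    where
    reversed : ∀ {x y} → does (precedes? Fin._≟_ L y x) ≡ true → Precedes L y x
    reversed {x} {y} = dec-true⁻ (precedes? Fin._≟_ L y x)

    present : ∀ {x} → x ∈ L → does (x DecMem.∈? L) ≡ true
    present {x} = dec-true (x DecMem.∈? L)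

    symmetric : ∀ u v → inversionEdge L u v ≡ inversionEdge L v u
    symmetric (inj₁ _) (inj₁ _) = refl
    symmetric (inj₁ _) (inj₂ _) = refl
    symmetric (inj₂ _) (inj₁ _) = refl
    symmetric (inj₂ _) (inj₂ _) = refl

    endpoints : ∀ u v → inversionEdge L u v ≡ true →
      vs (inversionGraph L) u ≡ true × vs (inversionGraph L) v ≡ true
    endpoints (inj₁ x) (inj₂ y) e =
      present (precedes-∈ʳ (reversed e)) , present (precedes-∈ˡ (reversed e))
    endpoints (inj₂ y) (inj₁ x) e =
      present (precedes-∈ˡ (reversed e)) , present (precedes-∈ʳ (reversed e))
    endpoints (inj₁ _) (inj₁ _) ()
    endpoints (inj₂ _) (inj₂ _) ()

    adjacent : ∀ u v → inversionEdge L u v ≡ true → GSplit P u v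
    adjacent (inj₁ x) (inj₂ y) e = GSplit⁺ (partialLinExt-precedes⇒⋠ L-linear (reversed e))
    adjacent (inj₂ y) (inj₁ x) e = swap (GSplit⁺ (partialLinExt-precedes⇒⋠ L-linear (reversed e)))
    adjacent (inj₁ _) (inj₁ _) ()
    adjacent (inj₂ _) (inj₂ _) ()

  inversionGraph-difference : ∀ {L} → Unique L → IsDifferenceGraph (inversionGraph L)
  inversionGraph-difference {L} uniq =
    isUpper , bipartite , map inj₂ L , Unique.map⁺ inj₂-injective uniq ,
    listed⇒upper , upper⇒listed , Linked.map⁺ (Linked.map dominates (linked-precedes L))
    where
    isUpper : Fin n ⊎ Fin n → Bool
    isUpper = [ (λ _ → false) , (λ _ → true) ]′

    bipartite : ∀ u v → inversionEdge L u v ≡ true → isUpper u ≢ isUpper v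
    bipartite (inj₁ _) (inj₂ _) _ ()
    bipartite (inj₂ _) (inj₁ _) _ ()
    bipartite (inj₁ _) (inj₁ _) ()
    bipartite (inj₂ _) (inj₂ _) ()

    listed⇒upper : ∀ a → a ∈ map inj₂ L → vs (inversionGraph L) a ≡ true × isUpper a ≡ true
    listed⇒upper a a∈ with ∈-map⁻ inj₂ a∈
    ... | x , x∈ , refl = dec-true (x DecMem.∈? L) x∈ , refl

    upper⇒listed : ∀ a → vs (inversionGraph L) a ≡ true → isUpper a ≡ true → a ∈ map inj₂ L
    upper⇒listed (inj₂ x) x∈ _ = ∈-map⁺ inj₂ (dec-true⁻ (x DecMem.∈? L) x∈)
    upper⇒listed (inj₁ _) _ ()

    dominates : ∀ {y z} → Precedes L y z →
      ∀ w → inversionEdge L (inj₂ z) w ≡ true → inversionEdge L (inj₂ y) w ≡ true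
    dominates {y} y<z (inj₁ x) e =
      dec-true (precedes? Fin._≟_ L y x) (precedes-trans uniq y<z (dec-true⁻ (precedes? Fin._≟_ L _ x) e))
    dominates _ (inj₂ _) ()

  localRealizer⇒localCovering : ∀ {k} → HasLocalRealizer k → HasLocalCovering (suc k)
  localRealizer⇒localCovering {k} (ℒ , realizer , load) =
    Gs , (members , (λ _ → edgelessGraph , here refl , refl) , edges) , load′
    where
    -- The edgeless graph covers the vertices of elements that lie in no member of ℒ.
    Gs : List (SubGraph (Fin n ⊎ Fin n))
    Gs = edgelessGraph ∷ map inversionGraph ℒ

    members : ∀ G → G ∈ Gs → IsSubgraphOf G (GSplit P) × IsDifferenceGraph G
    members _ (here refl) = edgeless-subgraph (GSplit P) , edgeless-difference
    members _ (there G∈) with ∈-map⁻ inversionGraph G∈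
    ... | L , L∈ , refl = inversionGraph-subgraph L-linear , inversionGraph-difference (proj₁ L-linear)
      where L-linear = proj₁ (proj₂ realizer) L L∈

    reversing : ∀ {x y} → ¬ x ≼ y → ∃ λ L → L ∈ ℒ × does (precedes? Fin._≟_ L y x) ≡ true
    reversing x⋠y with localRealizer-reverses realizer x⋠y
    ... | L , L∈ , y<x = L , L∈ , dec-true (precedes? Fin._≟_ L _ _) (Before⇒Precedes L y<x)

    edges : ∀ u v → GSplit P u v → ∃ λ G → G ∈ Gs × es G u v ≡ true
    edges (inj₁ x) (inj₂ y) adj = let L , L∈ , e = reversing (GSplit⁻ adj) in
      inversionGraph L , there (∈-map⁺ inversionGraph L∈) , e
    edges (inj₂ y) (inj₁ x) adj = let L , L∈ , e = reversing (GSplit⁻ (swap adj)) in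
      inversionGraph L , there (∈-map⁺ inversionGraph L∈) , e
    edges (inj₁ _) (inj₁ _) adj = ⊥-elim (¬GSplit-inj₁-inj₁ adj)
    edges (inj₂ _) (inj₂ _) adj = ⊥-elim (¬GSplit-inj₂-inj₂ adj)

    load′ : ∀ v → countG Gs v ≤ suc k
    load′ v = s≤s (begin
      length (filterᵇ (λ G → vs G v) (map inversionGraph ℒ))
        ≡⟨ length-filter-map (T? ∘ (λ G → vs G v)) inversionGraph ℒ ⟩
      length (filter (λ L → T? (does (reduce v DecMem.∈? L))) ℒ)
        ≤⟨ length-filter-mono _ _ (T-does⁻ (reduce v DecMem.∈? _)) ℒ ⟩
      count ℒ (reduce v)
        ≤⟨ load (reduce v) ⟩
      k ∎)
      where open ≤-Reasoning

  downset : Fin n → List (Fin n)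
  downset z = filter (_≼? z) (allFin n)

  ∈-downset⁺ : ∀ {u z} → u ≼ z → u ∈ downset z
  ∈-downset⁺ u≼z = ∈-filter⁺ (_≼? _) (∈-allFin _) u≼z

  ∈-downset⁻ : ∀ {u z} → u ∈ downset z → u ≼ z
  ∈-downset⁻ u∈ = proj₂ (∈-filter⁻ (_≼? _) {xs = allFin n} u∈)

  downset-mono : ∀ {x y} → x ≼ y → ∀ {u} → u ∈ downset x → u ∈ downset y
  downset-mono x≼y u∈ = ∈-downset⁺ (≼.trans (∈-downset⁻ u∈) x≼y)

  downsetSize : Fin n → ℕ
  downsetSize z = length (downset z)

  downsetSize-strict : ∀ {x y} → x ≺ y → downsetSize x < downsetSize y
  downsetSize-strict (x≼y , x≢y) =
    length-filter-< (_≼? _) (_≼? _) (λ u≼x → ≼.trans u≼x x≼y) (allFin n) (∈-allFin _) ≼.refl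
      (λ y≼x → x≢y (≼.antisym x≼y y≼x))

  downsetSize≤n : ∀ z → downsetSize z ≤ n
  downsetSize≤n z = ≤-trans (length-filter (_≼? z) (allFin n)) (≤-reflexive (length-tabulate _))

  linearExtension : List (Fin n)
  linearExtension = sortBy downsetSize (allFin n)

  module Linearisation (G : SubGraph (Fin n ⊎ Fin n)) where

    Arc : Fin n → Fin n → Set
    Arc x y = es G (inj₁ x) (inj₂ y) ≡ true

    outDegree : Fin n → ℕ
    outDegree x = length (filter (λ y → es G (inj₁ x) (inj₂ y) Bool.≟ true) (allFin n))

    maxOutDegreeBelow : Fin n → ℕ
    maxOutDegreeBelow z = max 0 (map outDegree (downset z))

    maxOutDegreeBelow-mono : ∀ {x y} → x ≼ y → maxOutDegreeBelow x ≤ maxOutDegreeBelow y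
    maxOutDegreeBelow-mono x≼y = max-mono-⊆ ≤-refl (Subset.map⁺ outDegree (downset-mono x≼y))

    -- Lexicographic in (maxOutDegreeBelow, downsetSize), since downsetSize z ≤ n.
    key : Fin n → ℕ
    key z = maxOutDegreeBelow z * suc n + downsetSize z

    key-strict : ∀ {x y} → x ≺ y → key x < key y
    key-strict x≺y =
      +-mono-≤-< (*-monoˡ-≤ (suc n) (maxOutDegreeBelow-mono (proj₁ x≺y))) (downsetSize-strict x≺y)

    key-maxOutDegreeBelow : ∀ {x y} → maxOutDegreeBelow y < maxOutDegreeBelow x → key y < key x
    key-maxOutDegreeBelow {x} {y} y<x = begin-strict
      maxOutDegreeBelow y * suc n + downsetSize y
        <⟨ +-monoʳ-< (maxOutDegreeBelow y * suc n) (s≤s (downsetSize≤n y)) ⟩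
      maxOutDegreeBelow y * suc n + suc n
        ≡⟨ +-comm (maxOutDegreeBelow y * suc n) (suc n) ⟩
      suc (maxOutDegreeBelow y) * suc n
        ≤⟨ *-monoˡ-≤ (suc n) y<x ⟩
      maxOutDegreeBelow x * suc n
        ≤⟨ m≤m+n _ _ ⟩
      key x ∎
      where open ≤-Reasoning

    Visible : Fin n → Set
    Visible x = vs G (inj₁ x) ≡ true ⊎ vs G (inj₂ x) ≡ true

    visible? : U.Decidable Visible
    visible? x = (vs G (inj₁ x) Bool.≟ true) ⊎-dec (vs G (inj₂ x) Bool.≟ true)

    linearisation : List (Fin n)
    linearisation = sortBy key (filter visible? (allFin n))

    linearisation-partialLinExt : IsPartialLinExt linearisation
    linearisation-partialLinExt =
      sortBy-partialLinExt key key-strict (Unique.filter⁺ visible? (Unique.allFin⁺ n))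

    ∈-linearisation⁻ : ∀ {x} → x ∈ linearisation → Visible x
    ∈-linearisation⁻ x∈ = proj₂ (∈-filter⁻ visible? {xs = allFin n} (∈-sortBy⁻ key x∈))

    module _ (G⊆ : IsSubgraphOf G (GSplit P)) (difference : IsDifferenceGraph G) where
      private
        adjacent : ∀ {u v} → es G u v ≡ true → GSplit P u v
        adjacent = proj₂ (proj₂ G⊆) _ _

      arc-dominates : ∀ {a b u} → Arc a b → u ≼ b → ∀ {w} → Arc u w → Arc a w
      arc-dominates ab u≼b uw with difference-2K2-free G⊆ difference uw ab
      ... | inj₁ ub                = ⊥-elim (GSplit⁻ (adjacent ub) u≼b)
      ... | inj₂ (inj₁ aw)         = aw
      ... | inj₂ (inj₂ (inj₁ ua))  = ⊥-elim (¬GSplit-inj₁-inj₁ (adjacent ua))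
      ... | inj₂ (inj₂ (inj₂ wb))  = ⊥-elim (¬GSplit-inj₂-inj₂ (adjacent wb))

      outDegree-below-arc : ∀ {a b u} → Arc a b → u ≼ b → outDegree u < outDegree a
      outDegree-below-arc ab u≼b =
        length-filter-< _ _ (arc-dominates ab u≼b) (allFin n) (∈-allFin _) ab
          (λ ub → GSplit⁻ (adjacent ub) u≼b)

      maxOutDegreeBelow-arc : ∀ {a b} → Arc a b → maxOutDegreeBelow b < maxOutDegreeBelow a
      maxOutDegreeBelow-arc {a} {b} ab = <-≤-trans
        (max<v⁺ (≤-trans (s≤s z≤n) (outDegree-below-arc ab ≼.refl))
          (All.map⁺ (All.tabulate (outDegree-below-arc ab ∘ ∈-downset⁻))))
        (All.lookup (xs≤max 0 (map outDegree (downset a))) (∈-map⁺ outDegree (∈-downset⁺ ≼.refl)))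

      linearisation-reverses : ∀ {a b} → Arc a b → Before linearisation b a
      linearisation-reverses {a} {b} ab = Precedes⇒Before (sortBy-precedes key
        (∈-filter⁺ visible? (∈-allFin b) (inj₂ (proj₂ endpoints)))
        (∈-filter⁺ visible? (∈-allFin a) (inj₁ (proj₁ endpoints)))
        (key-maxOutDegreeBelow (maxOutDegreeBelow-arc ab)))
        where endpoints = proj₁ (proj₂ G⊆) _ _ ab

  localCovering⇒localRealizer : ∀ {c} → HasLocalCovering c → HasLocalRealizer (suc (c + c))
  localCovering⇒localRealizer {c} (Gs , (members , _ , edges) , load) =
    ℒ , ((linearExtension , here refl) , linear , comparable , incomparable) , load′
    where
    open Linearisation using (linearisation)

    ℒ : List (List (Fin n))
    ℒ = linearExtension ∷ map linearisation Gs

    linear : ∀ L → L ∈ ℒ → IsPartialLinExt L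
    linear _ (here refl) = sortBy-partialLinExt downsetSize downsetSize-strict (Unique.allFin⁺ n)
    linear _ (there L∈) with ∈-map⁻ linearisation L∈
    ... | G , _ , refl = Linearisation.linearisation-partialLinExt G

    comparable : ∀ x y → x ≺ y → ∃ λ L → L ∈ ℒ × Before L x y
    comparable x y x≺y = linearExtension , here refl , Precedes⇒Before
      (sortBy-precedes downsetSize (∈-allFin x) (∈-allFin y) (downsetSize-strict x≺y))

    reversing : ∀ {x y} → ¬ x ≼ y → ∃ λ L → L ∈ ℒ × Before L y x
    reversing x⋠y with edges (inj₁ _) (inj₂ _) (GSplit⁺ x⋠y)
    ... | G , G∈ , arc = linearisation G , there (∈-map⁺ linearisation G∈) ,
      Linearisation.linearisation-reverses G (proj₁ (members G G∈)) (proj₂ (members G G∈)) arc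

    incomparable : ∀ x y → x ∥ y →
      (∃ λ L → L ∈ ℒ × Before L x y) × (∃ λ L → L ∈ ℒ × Before L y x)
    incomparable x y (x⋠y , y⋠x) = reversing y⋠x , reversing x⋠y

    linearisationLoad : ∀ x → count (map linearisation Gs) x ≤ c + c
    linearisationLoad x = begin
      count (map linearisation Gs) x
        ≡⟨ length-filter-map (x DecMem.∈?_) linearisation Gs ⟩
      length (filter (λ G → x DecMem.∈? linearisation G) Gs)
        ≤⟨ length-filter-mono _ _ (λ {G} x∈ → Sum.map (Equivalence.from T-≡) (Equivalence.from T-≡)
                                     (Linearisation.∈-linearisation⁻ G x∈)) Gs ⟩
      length (filter (λ G → T? (vs G (inj₁ x)) ⊎-dec T? (vs G (inj₂ x))) Gs)
        ≤⟨ length-filter-⊎ _ _ Gs ⟩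
      countG Gs (inj₁ x) + countG Gs (inj₂ x)
        ≤⟨ +-mono-≤ (load (inj₁ x)) (load (inj₂ x)) ⟩
      c + c ∎
      where open ≤-Reasoning

    load′ : ∀ x → count ℒ x ≤ suc (c + c)
    load′ x with x DecMem.∈? linearExtension
    ... | yes _ = s≤s (linearisationLoad x)
    ... | no _  = m≤n⇒m≤1+n (linearisationLoad x)

lc≤ldim+1 : ∀ {n} (P : FinPoset n) {d c} → IsLdim P d → IsLcD (GSplit P) c → c ≤ d + 1
lc≤ldim+1 P {d} (realizer , _) (_ , least) =
  ≤-trans (least _ (localRealizer⇒localCovering P realizer)) (≤-reflexive (+-comm 1 d))

ldim≤2lc+1 : ∀ {n} (P : FinPoset n) {d c} → IsLdim P d → IsLcD (GSplit P) c → d ≤ suc (c + c)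
ldim≤2lc+1 P (_ , least) (covering , _) = least _ (localCovering⇒localRealizer P covering)

1+2c≤3c : ∀ {c} → 1 ≤ c → suc (c + c) ≤ 3 * c
1+2c≤3c {c} 1≤c = begin
  suc (c + c)  ≤⟨ +-monoˡ-≤ (c + c) 1≤c ⟩
  c + (c + c)  ≡⟨ cong (λ t → c + (c + t)) (sym (+-identityʳ c)) ⟩
  3 * c        ∎
  where open ≤-Reasoning

ldim≤3lc : ∀ {n} (P : FinPoset n) {d c} → 1 ≤ n → IsLdim P d → IsLcD (GSplit P) c → d ≤ 3 * c
ldim≤3lc P 1≤n ldim lc = ≤-trans (ldim≤2lc+1 P ldim lc) (1+2c≤3c c-positive)
  where c-positive = localCovering-positive (GSplit P) (inj₁ (Fin.fromℕ< 1≤n)) (proj₁ lc)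

2^[d*q]≤n^[c*[q+p]] : ∀ {n d} c p q → 8 ≤ n → d ≤ 3 * c → 2 ^ (d * q) ≤ n ^ (c * (q + p))
2^[d*q]≤n^[c*[q+p]] {n} {d} c p q 8≤n d≤3c = begin
  2 ^ (d * q)        ≤⟨ ^-monoʳ-≤ 2 (*-monoˡ-≤ q d≤3c) ⟩
  2 ^ (3 * c * q)    ≡⟨ cong (2 ^_) (*-assoc 3 c q) ⟩
  2 ^ (3 * (c * q))  ≡⟨ ^-*-assoc 2 3 (c * q) ⟨
  8 ^ (c * q)        ≤⟨ ^-monoʳ-≤ 8 (*-monoʳ-≤ c (m≤m+n q p)) ⟩
  8 ^ (c * (q + p))  ≤⟨ ^-monoˡ-≤ (c * (q + p)) 8≤n ⟩
  n ^ (c * (q + p))  ∎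
  where open ≤-Reasoning

corollary8 :
    ((n : ℕ) (P : FinPoset n) (d c : ℕ) →
      IsLdim P d → IsLcD (GSplit P) c → c ≤ d + 4)
    ×
    ((p q : ℕ) → 1 ≤ p → 1 ≤ q →
      ∃ λ N → (n : ℕ) → N ≤ n → (P : FinPoset n) (d c : ℕ) →
        IsLdim P d → IsLcD (GSplit P) c →
        2 ^ (d * q) ≤ n ^ (c * (q + p)))
corollary8 =
  (λ n P d c ldim lc → ≤-trans (lc≤ldim+1 P ldim lc) (+-monoʳ-≤ d (s≤s z≤n))) ,
  (λ p q _ _ → 8 , λ n 8≤n P d c ldim lc →
    2^[d*q]≤n^[c*[q+p]] c p q 8≤n (ldim≤3lc P (≤-trans (s≤s z≤n) 8≤n) ldim lc))
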